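{- Let $C$ and $P$ be graphs, let $\overline{P}=\{P_1,\dots,P_k\}$ be a covering of $P$ satisfying condition A, and let $\rho\in\mathbb{N}$ with $\rho\geq\min\{\mathrm{diam}(C),2\}$. Define the graph $G=\mathcal{G}(C,P,\overline{P},\rho)$ with vertex set $V(C)\cup V(P)\cup\{x_{i,j}: 0\leq i\leq k,\ 1\leq j\leq\rho\}$ (disjoint union, the $x_{i,j}$ new vertices), where $ab$ is an edge iff one of: $ab$ is an edge of $C$; $ab$ is an edge of $P$; $a\in V(C)$ and $b=x_{i,1}$ for some $0\leq i\leq k$; $a\in P_i$ and $b=x_{i,\rho}$ for some $1\leq i\leq k$; $a=x_{i,j}$ and $b=x_{i,j+1}$ for some $0\leq i\leq k$, $1\leq j\leq\rho-1$. Then $G$ is a uniform central graph with radius $\rho+1$, $\langle Z(G)\rangle=C$ and $\langle CP(G)\rangle=P$.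
   Context: All graphs are finite and simple; $\mathbb{N}$ is the positive integers. $d(u,v)$ is the distance; for a vertex $p$ and vertex set $S$, $d(S,p)=\min_{s\in S}d(s,p)$. Eccentricity $e(v)=\max_u d(u,v)$; radius = minimum eccentricity, $\mathrm{diam}$ = maximum eccentricity. For a graph $H$: the center $Z(H)$ is the set of vertices of minimum eccentricity; $EC(v)=\{x: d(v,x)=e(v)\}$; the centered periphery is $CP(H)=\bigcup_{z\in Z(H)} EC(z)$; $\langle S\rangle$ is the induced subgraph on $S$. $H$ is a uniform central graph if $EC(c)$ is the same for all $c\in Z(H)$. A covering of $P$ is a family $\{P_1,\dots,P_k\}$ of subsets of $V(P)$ with $\bigcup P_i=V(P)$. Condition A: for each $i$ there is $p\notin P_i$ with $d_P(P_i,p)\geq 2$. -}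

module Defs where

open import Data.Nat using (ℕ; zero; suc; _≤_; _<_)
open import Data.Fin using (Fin; zero; suc)
open import Data.Bool using (Bool; true; false)
open import Data.Product using (Σ; ∃; ∃-syntax; _×_; _,_)
open import Relation.Nullary using (¬_)
open import Relation.Binary.PropositionalEquality using (_≡_)

record Graph : Set where
  field
    n      : ℕ
    adj    : Fin n → Fin n → Bool
    sym    : ∀ u v → adj u v ≡ adj v u
    irrefl : ∀ v → adj v v ≡ false

Edge : (g : Graph) → Fin (Graph.n g) → Fin (Graph.n g) → Set
Edge g u v = Graph.adj g u v ≡ true

module Metric {V : Set} (E : V → V → Set) where

  data Walk : V → V → ℕ → Set where
    nil  : ∀ {v} → Walk v v 0
    cons : ∀ {u w v m} → E u w → Walk w v m → Walk u v (suc m)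

  -- d(u,v) ≥ d   (also holds when d(u,v) = ∞)
  DistGE : V → V → ℕ → Set
  DistGE u v d = ∀ m → m < d → ¬ Walk u v m

  Dist : V → V → ℕ → Set
  Dist u v d = Walk u v d × DistGE u v d

  DistLE : V → V → ℕ → Set
  DistLE u v d = ∃[ m ] (m ≤ d × Walk u v m)

  Ecc : V → ℕ → Set
  Ecc v e = (∀ u → DistLE v u e) × (∃[ u ] Dist v u e)

  Radius : ℕ → Set
  Radius r = (∃[ v ] Ecc v r) × (∀ v e → Ecc v e → r ≤ e)

  DiamLE : ℕ → Set
  DiamLE d = ∀ u v → DistLE u v d

  InCenter : V → Set
  InCenter v = ∃[ r ] (Radius r × Ecc v r)

  InEC : V → V → Set
  InEC v x = ∃[ e ] (Ecc v e × Dist v x e)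

  InCP : V → Set
  InCP x = ∃[ z ] (InCenter z × InEC z x)

  UniformCentral : Set
  UniformCentral = ∀ c c' → InCenter c → InCenter c' → ∀ x → InEC c x → InEC c' x

-- The covering P̄ = {P_1,…,P_k} is  Cov : Fin k → Fin (n P) → Bool,
-- where P_{i+1} = { p | Cov i p ≡ true } for i : Fin k.
-- Chains are indexed by Fin (suc k): zero is chain 0, suc i is chain i+1.

module Construction (C P : Graph) (k : ℕ) (Cov : Fin k → Fin (Graph.n P) → Bool) (ρ : ℕ) where

  data GV : Set where
    cV : Fin (Graph.n C) → GV
    pV : Fin (Graph.n P) → GV
    xV : (i : Fin (suc k)) (j : ℕ) → 1 ≤ j → j ≤ ρ → GV

  data GE : GV → GV → Set where
    cc  : ∀ {a b} → Edge C a b → GE (cV a) (cV b)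
    pp  : ∀ {a b} → Edge P a b → GE (pV a) (pV b)
    cx  : ∀ a i p q → GE (cV a) (xV i 1 p q)
    xc  : ∀ a i p q → GE (xV i 1 p q) (cV a)
    px  : ∀ a i p q → Cov i a ≡ true → GE (pV a) (xV (suc i) ρ p q)
    xp  : ∀ a i p q → Cov i a ≡ true → GE (xV (suc i) ρ p q) (pV a)
    xx  : ∀ i j p q p' q' → GE (xV i j p q) (xV i (suc j) p' q')
    xx' : ∀ i j p q p' q' → GE (xV i (suc j) p' q') (xV i j p q)

IsCovering : (P : Graph) (k : ℕ) → (Fin k → Fin (Graph.n P) → Bool) → Set
IsCovering P k Cov = ∀ p → ∃[ i ] (Cov i p ≡ true)

ConditionA : (P : Graph) (k : ℕ) → (Fin k → Fin (Graph.n P) → Bool) → Set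
ConditionA P k Cov =
  ∀ i → ∃[ p ] (Cov i p ≡ false × (∀ s → Cov i s ≡ true → Metric.DistGE (Edge P) s p 2))

-- Three vertex potentials that grow by at most one along every edge bound distances from
-- below: the height d(C, ·), the distance from the tip x_{0,ρ} of chain 0, and, for each
-- chain i, a lower bound on the distance from the vertex p ∉ P_i given by condition A.
-- With them, every vertex of C has eccentricity ρ + 1, attained exactly on P, while every
-- other vertex has some vertex at distance at least ρ + 2. The centre is therefore C and
-- all central vertices share the eccentric set P.
module Submission where

open import Defs
open import Data.Nat using (ℕ; zero; suc; _+_; _∸_; _≤_; z≤n; s≤s)
open import Data.Nat.Properties hiding (_≟_)
open import Data.Fin using (Fin; zero; suc; _≟_)
open import Data.Bool using (Bool; true; false; if_then_else_)
open import Data.Bool.Properties using (not-¬)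
open import Data.Sum using (_⊎_; inj₁; inj₂)
open import Data.Product using (_×_; _,_; proj₁; proj₂; ∃-syntax)
open import Data.Empty using (⊥-elim)
open import Function using (case_of_)
open import Function.Bundles using (_⇔_; mk⇔; module Equivalence)
open import Relation.Nullary using (yes; no; does)
open import Relation.Nullary.Decidable using (dec-true)
open import Relation.Binary.PropositionalEquality using (_≡_; refl; sym; trans; cong)

open Equivalence using (to; from)

module MetricProperties {V : Set} (E : V → V → Set) where
  open Metric E

  Walk-snoc : ∀ {u v w m} → Walk u v m → E v w → Walk u w (suc m)
  Walk-snoc nil e = cons e nil
  Walk-snoc (cons e′ w) e = cons e′ (Walk-snoc w e)

  Walk-reverse : (∀ {u w} → E u w → E w u) → ∀ {u v m} → Walk u v m → Walk v u m
  Walk-reverse E-sym nil = nil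
  Walk-reverse E-sym (cons e w) = Walk-snoc (Walk-reverse E-sym w) (E-sym e)

  DistGE-sym : (∀ {u w} → E u w → E w u) → ∀ {u v d} → DistGE u v d → DistGE v u d
  DistGE-sym E-sym ge m m<d w = ge m m<d (Walk-reverse E-sym w)

  DistLE∧DistGE⇒≤ : ∀ {u v a b} → DistLE u v a → DistGE u v b → b ≤ a
  DistLE∧DistGE⇒≤ (m , m≤a , w) ge = ≤-trans (≮⇒≥ (λ m<b → ge m m<b w)) m≤a

  Lipschitz : (V → ℕ) → Set
  Lipschitz f = ∀ {u w} → E u w → f w ≤ suc (f u)

  Lipschitz-Walk : ∀ {f} → Lipschitz f → ∀ {u v m} → Walk u v m → f v ≤ m + f u
  Lipschitz-Walk lip nil = ≤-refl
  Lipschitz-Walk {f} lip {u} {m = suc m} (cons e w) =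
    ≤-trans (Lipschitz-Walk lip w) (≤-trans (+-monoʳ-≤ m (lip e)) (≤-reflexive (+-suc m (f u))))

  Lipschitz⇒DistGE : ∀ {f} → Lipschitz f → ∀ {u v d} → d + f u ≤ f v → DistGE u v d
  Lipschitz⇒DistGE {f} lip {u} d+fu≤fv m m<d w =
    n≮n (m + f u) (<-≤-trans (+-monoˡ-< (f u) m<d) (≤-trans d+fu≤fv (Lipschitz-Walk lip w)))

  Ecc⇒≥ : ∀ {v t d e} → Ecc v e → DistGE v t d → d ≤ e
  Ecc⇒≥ (le , _) ge = DistLE∧DistGE⇒≤ (le _) ge

  Ecc-unique : ∀ {v e e′} → Ecc v e → Ecc v e′ → e ≡ e′
  Ecc-unique ecc@(_ , _ , _ , ge) ecc′@(_ , _ , _ , ge′) = ≤-antisym (Ecc⇒≥ ecc′ ge) (Ecc⇒≥ ecc ge′)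

  Ecc∧EC-outer-layer : ∀ {v r} (T : V → Set) → ∃[ t ] T t →
    (∀ x → T x → Dist v x (suc r)) → (∀ x → T x ⊎ DistLE v x r) →
    Ecc v (suc r) × (∀ x → InEC v x ⇔ T x)
  Ecc∧EC-outer-layer {v} {r} T (t , Tt) outer inner = ecc , λ x → mk⇔ (EC⇒T x) (T⇒EC x)
    where
      within : ∀ x → DistLE v x (suc r)
      within x with inner x
      ... | inj₁ Tx = suc r , ≤-refl , proj₁ (outer x Tx)
      ... | inj₂ (m , m≤r , w) = m , m≤n⇒m≤1+n m≤r , w

      ecc : Ecc v (suc r)
      ecc = within , t , outer t Tt

      EC⇒T : ∀ x → InEC v x → T x
      EC⇒T x (e , ecc′ , _ , ge) with Ecc-unique ecc ecc′ | inner x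
      ... | _    | inj₁ Tx = Tx
      ... | refl | inj₂ le = ⊥-elim (n≮n r (DistLE∧DistGE⇒≤ le ge))

      T⇒EC : ∀ x → T x → InEC v x
      T⇒EC x Tx = suc r , ecc , outer x Tx

  centre-characterisation : ∀ {r} (S : V → Set) → ∃[ s ] S s → (∀ v → S v → Ecc v r) →
    (∀ v → S v ⊎ ∃[ t ] DistGE v t (suc r)) →
    Radius r × (∀ v → InCenter v ⇔ S v)
  centre-characterisation {r} S (s , Ss) eccS split = radius , λ v → mk⇔ (centre⇒S v) (S⇒centre v)
    where
      minimal : ∀ v e → Ecc v e → r ≤ e
      minimal v e ecc with split v
      ... | inj₁ Sv = ≤-reflexive (Ecc-unique (eccS v Sv) ecc)
      ... | inj₂ (_ , ge) = ≤-trans (n≤1+n r) (Ecc⇒≥ ecc ge)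

      radius : Radius r
      radius = (s , eccS s Ss) , minimal

      centre⇒S : ∀ v → InCenter v → S v
      centre⇒S v (r′ , (_ , r′-min) , ecc) with split v
      ... | inj₁ Sv = Sv
      ... | inj₂ (_ , ge) = ⊥-elim (n≮n r (≤-trans (Ecc⇒≥ ecc ge) (r′-min s r (eccS s Ss))))

      S⇒centre : ∀ v → S v → InCenter v
      S⇒centre v Sv = r , radius , eccS v Sv

  uniform-central : (T : V → Set) → ∃[ c ] InCenter c →
    (∀ c → InCenter c → ∀ x → InEC c x ⇔ T x) →
    UniformCentral × (∀ x → InCP x ⇔ T x)
  uniform-central T (c₀ , c₀-centre) EC⇔T =
      (λ c c′ c-centre c′-centre x x∈EC → from (EC⇔T c′ c′-centre x) (to (EC⇔T c c-centre x) x∈EC))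
    , λ x → mk⇔ (λ (c , c-centre , x∈EC) → to (EC⇔T c c-centre x) x∈EC)
                (λ Tx → c₀ , c₀-centre , from (EC⇔T c₀ c₀-centre x) Tx)

m∸n≤1+m∸[1+n] : ∀ m n → m ∸ n ≤ suc (m ∸ suc n)
m∸n≤1+m∸[1+n] zero zero = z≤n
m∸n≤1+m∸[1+n] zero (suc n) = z≤n
m∸n≤1+m∸[1+n] (suc m) zero = ≤-refl
m∸n≤1+m∸[1+n] (suc m) (suc n) = m∸n≤1+m∸[1+n] m n

m∸[1+n]≤1+m∸n : ∀ m n → m ∸ suc n ≤ suc (m ∸ n)
m∸[1+n]≤1+m∸n m n = m≤n⇒m≤1+n (∸-monoʳ-≤ m (n≤1+n n))

m≤1+n⇒o+m≤1+o+n : ∀ o {m n} → m ≤ suc n → o + m ≤ suc (o + n)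
m≤1+n⇒o+m≤1+o+n o {n = n} m≤1+n = ≤-trans (+-monoʳ-≤ o m≤1+n) (≤-reflexive (+-suc o n))

module ConstructionProperties (C P : Graph) (k : ℕ) (Cov : Fin k → Fin (Graph.n P) → Bool)
                              (ρ : ℕ) (1≤ρ : 1 ≤ ρ) where
  open Construction C P k Cov ρ
  open Metric GE
  open MetricProperties GE

  IsC IsP : GV → Set
  IsC v = ∃[ a ] (v ≡ cV a)
  IsP v = ∃[ p ] (v ≡ pV p)

  GE-sym : ∀ {u w} → GE u w → GE w u
  GE-sym (cc {a} {b} e) = cc (trans (Graph.sym C b a) e)
  GE-sym (pp {a} {b} e) = pp (trans (Graph.sym P b a) e)
  GE-sym (cx a i p q) = xc a i p q
  GE-sym (xc a i p q) = cx a i p q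
  GE-sym (px a i p q c) = xp a i p q c
  GE-sym (xp a i p q c) = px a i p q c
  GE-sym (xx i j p q p′ q′) = xx' i j p q p′ q′
  GE-sym (xx' i j p q p′ q′) = xx i j p q p′ q′

  1+[ρ∸1]≡ρ : suc (ρ ∸ 1) ≡ ρ
  1+[ρ∸1]≡ρ = m+[n∸m]≡n 1≤ρ

  descend : ∀ a i j (1≤j : 1 ≤ j) (j≤ρ : j ≤ ρ) → Walk (xV i j 1≤j j≤ρ) (cV a) j
  descend a i (suc zero) 1≤j j≤ρ = cons (xc a i 1≤j j≤ρ) nil
  descend a i (suc (suc j)) 1≤j j≤ρ =
    cons (xx' i (suc j) (s≤s z≤n) j+1≤ρ 1≤j j≤ρ) (descend a i (suc j) (s≤s z≤n) j+1≤ρ)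
    where
      j+1≤ρ : suc j ≤ ρ
      j+1≤ρ = ≤-trans (n≤1+n _) j≤ρ

  height : GV → ℕ
  height (cV _) = 0
  height (pV _) = suc ρ
  height (xV _ j _ _) = j

  height-lipschitz : Lipschitz height
  height-lipschitz (cc _) = z≤n
  height-lipschitz (pp _) = n≤1+n _
  height-lipschitz (cx _ _ _ _) = ≤-refl
  height-lipschitz (xc _ _ _ _) = z≤n
  height-lipschitz (px _ _ _ _ _) = m≤n⇒m≤1+n (n≤1+n ρ)
  height-lipschitz (xp _ _ _ _ _) = ≤-refl
  height-lipschitz (xx _ _ _ _ _ _) = ≤-refl
  height-lipschitz (xx' _ _ _ _ _ _) = m≤n⇒m≤1+n (n≤1+n _)

  dist-C-P : IsCovering P k Cov → ∀ a p → Dist (cV a) (pV p) (suc ρ)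
  dist-C-P cover a p with cover p
  ... | i , p∈Pᵢ =
      Walk-reverse GE-sym (cons (px p i 1≤ρ ≤-refl p∈Pᵢ) (descend a (suc i) ρ 1≤ρ ≤-refl))
    , Lipschitz⇒DistGE height-lipschitz (≤-reflexive (+-identityʳ (suc ρ)))

  C-within-ρ : 2 ≤ ρ ⊎ Metric.DiamLE (Edge C) ρ → ∀ a x → IsP x ⊎ DistLE (cV a) x ρ
  C-within-ρ _ a (pV p) = inj₁ (p , refl)
  C-within-ρ _ a (xV i j 1≤j j≤ρ) = inj₂ (j , j≤ρ , Walk-reverse GE-sym (descend a i j 1≤j j≤ρ))
  C-within-ρ (inj₁ 2≤ρ) a (cV b) =
    inj₂ (2 , 2≤ρ , cons (cx a zero (s≤s z≤n) 1≤ρ) (cons (xc b zero (s≤s z≤n) 1≤ρ) nil))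
  C-within-ρ (inj₂ diam≤ρ) a (cV b) with diam≤ρ a b
  ... | m , m≤ρ , w = inj₂ (m , m≤ρ , lift w)
    where
      lift : ∀ {a b m} → Metric.Walk (Edge C) a b m → Walk (cV a) (cV b) m
      lift Metric.nil = nil
      lift (Metric.cons e w) = cons (cc e) (lift w)

  tip : GV
  tip = xV zero ρ 1≤ρ ≤-refl

  fromTip : GV → ℕ
  fromTip (cV _) = ρ
  fromTip (pV _) = ρ + suc ρ
  fromTip (xV zero j _ _) = ρ ∸ j
  fromTip (xV (suc _) j _ _) = ρ + j

  fromTip-lipschitz : Lipschitz fromTip
  fromTip-lipschitz (cc _) = n≤1+n ρ
  fromTip-lipschitz (pp _) = n≤1+n _
  fromTip-lipschitz (cx _ zero _ _) = m≤n⇒m≤1+n (m∸n≤m ρ 1)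
  fromTip-lipschitz (cx _ (suc _) _ _) = ≤-reflexive (+-comm ρ 1)
  fromTip-lipschitz (xc _ zero _ _) = ≤-reflexive (sym 1+[ρ∸1]≡ρ)
  fromTip-lipschitz (xc _ (suc _) _ _) = m≤n⇒m≤1+n (m≤m+n ρ 1)
  fromTip-lipschitz (px _ _ _ _ _) = m≤n⇒m≤1+n (+-monoʳ-≤ ρ (n≤1+n ρ))
  fromTip-lipschitz (xp _ _ _ _ _) = ≤-reflexive (+-suc ρ ρ)
  fromTip-lipschitz (xx zero j _ _ _ _) = m∸[1+n]≤1+m∸n ρ j
  fromTip-lipschitz (xx (suc _) j _ _ _ _) = ≤-reflexive (+-suc ρ j)
  fromTip-lipschitz (xx' zero j _ _ _ _) = m∸n≤1+m∸[1+n] ρ j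
  fromTip-lipschitz (xx' (suc _) j _ _ _ _) = m≤n⇒m≤1+n (+-monoʳ-≤ ρ (n≤1+n j))

  far-from-tip : ∀ v → suc (suc ρ) ≤ fromTip v → DistGE v tip (suc (suc ρ))
  far-from-tip v ρ+2≤ = DistGE-sym GE-sym (Lipschitz⇒DistGE fromTip-lipschitz bound)
    where
      bound : suc (suc ρ) + (ρ ∸ ρ) ≤ fromTip v
      bound rewrite n∸n≡0 ρ | +-identityʳ (suc (suc ρ)) = ρ+2≤

  chain₀-far-from-P : ∀ j 1≤j j≤ρ p → DistGE (xV zero j 1≤j j≤ρ) (pV p) (suc (suc ρ))
  chain₀-far-from-P j 1≤j j≤ρ p = Lipschitz⇒DistGE fromTip-lipschitz (begin
    suc (suc ρ) + (ρ ∸ j)  ≤⟨ +-monoʳ-≤ (suc (suc ρ)) (∸-monoʳ-≤ ρ 1≤j) ⟩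
    suc (suc ρ) + (ρ ∸ 1)  ≡⟨ sym (+-suc (suc ρ) (ρ ∸ 1)) ⟩
    suc ρ + suc (ρ ∸ 1)    ≡⟨ cong (suc ρ +_) 1+[ρ∸1]≡ρ ⟩
    suc ρ + ρ              ≡⟨ +-comm (suc ρ) ρ ⟩
    ρ + suc ρ              ∎)
    where open ≤-Reasoning

  -- P_i is at distance at least 2 from p, so the chain attached to P_i gets a bonus of 2.
  module FromWitness (i : Fin k) (p : Fin (Graph.n P)) (p∉Pᵢ : Cov i p ≡ false)
                     (Pᵢ-far : ∀ s → Cov i s ≡ true → Metric.DistGE (Edge P) s p 2) where

    bonus : Fin k → ℕ
    bonus i′ = if does (i′ ≟ i) then 2 else 0

    fromWitness : GV → ℕ
    fromWitness (cV _) = suc ρ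
    fromWitness (pV q) = if does (q ≟ p) then 0 else (if Cov i q then 2 else 1)
    fromWitness (xV zero j _ _) = suc (ρ ∸ j)
    fromWitness (xV (suc i′) j _ _) = bonus i′ + suc (ρ ∸ j)

    fromWitness-P≤2 : ∀ q → fromWitness (pV q) ≤ 2
    fromWitness-P≤2 q with does (q ≟ p) | Cov i q
    ... | true  | _     = z≤n
    ... | false | true  = ≤-refl
    ... | false | false = s≤s z≤n

    fromWitness-lipschitz-P : ∀ {a b} → Edge P a b → fromWitness (pV b) ≤ suc (fromWitness (pV a))
    fromWitness-lipschitz-P {a} {b} e with b ≟ p | Cov i b in b∈? | a ≟ p
    ... | yes _ | _     | _        = z≤n
    ... | no _  | false | _        = s≤s z≤n
    ... | no _  | true  | yes refl = ⊥-elim (Pᵢ-far b b∈? 1 (s≤s (s≤s z≤n))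
                                               (Metric.cons (trans (Graph.sym P b a) e) Metric.nil))
    ... | no _  | true  | no _ with Cov i a
    ...   | true  = s≤s (s≤s z≤n)
    ...   | false = ≤-refl

    fromWitness-lipschitz : Lipschitz fromWitness
    fromWitness-lipschitz (cc _) = n≤1+n _
    fromWitness-lipschitz (pp e) = fromWitness-lipschitz-P e
    fromWitness-lipschitz (cx _ zero _ _) = s≤s (m≤n⇒m≤1+n (m∸n≤m ρ 1))
    fromWitness-lipschitz (cx _ (suc i′) _ _) with does (i′ ≟ i)
    ... | true  = ≤-reflexive (cong (2 +_) 1+[ρ∸1]≡ρ)
    ... | false = s≤s (m≤n⇒m≤1+n (m∸n≤m ρ 1))
    fromWitness-lipschitz (xc _ zero _ _) = s≤s (≤-reflexive (sym 1+[ρ∸1]≡ρ))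
    fromWitness-lipschitz (xc _ (suc i′) _ _) =
      s≤s (≤-trans (≤-reflexive (sym 1+[ρ∸1]≡ρ)) (m≤n+m _ (bonus i′)))
    fromWitness-lipschitz (px a i′ _ _ a∈Pᵢ′) with i′ ≟ i
    ... | no _ rewrite n∸n≡0 ρ = s≤s z≤n
    ... | yes refl with a ≟ p
    ...   | yes refl = ⊥-elim (not-¬ a∈Pᵢ′ p∉Pᵢ)
    ...   | no _ rewrite a∈Pᵢ′ | n∸n≡0 ρ = ≤-refl
    fromWitness-lipschitz (xp a i′ _ _ _) =
      ≤-trans (fromWitness-P≤2 a) (s≤s (≤-trans (s≤s z≤n) (m≤n+m _ (bonus i′))))
    fromWitness-lipschitz (xx zero j _ _ _ _) = s≤s (m∸[1+n]≤1+m∸n ρ j)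
    fromWitness-lipschitz (xx (suc i′) j _ _ _ _) =
      m≤1+n⇒o+m≤1+o+n (bonus i′) (s≤s (m∸[1+n]≤1+m∸n ρ j))
    fromWitness-lipschitz (xx' zero j _ _ _ _) = s≤s (m∸n≤1+m∸[1+n] ρ j)
    fromWitness-lipschitz (xx' (suc i′) j _ _ _ _) =
      m≤1+n⇒o+m≤1+o+n (bonus i′) (s≤s (m∸n≤1+m∸[1+n] ρ j))

    chain-foot-far : ∀ 1≤1 1≤ρ′ → DistGE (xV (suc i) 1 1≤1 1≤ρ′) (pV p) (suc (suc ρ))
    chain-foot-far 1≤1 1≤ρ′ = DistGE-sym GE-sym (Lipschitz⇒DistGE fromWitness-lipschitz bound)
      where
        bound : suc (suc ρ) + fromWitness (pV p) ≤ fromWitness (xV (suc i) 1 1≤1 1≤ρ′)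
        bound rewrite dec-true (p ≟ p) refl | dec-true (i ≟ i) refl
                    | +-identityʳ (suc (suc ρ)) | 1+[ρ∸1]≡ρ = ≤-refl

  C-ecc∧EC : IsCovering P k Cov → 2 ≤ ρ ⊎ Metric.DiamLE (Edge C) ρ → Fin (Graph.n P) →
    ∀ a → Ecc (cV a) (suc ρ) × (∀ x → InEC (cV a) x ⇔ IsP x)
  C-ecc∧EC cover small-diam p₀ a = Ecc∧EC-outer-layer IsP (pV p₀ , p₀ , refl)
    (λ { _ (p , refl) → dist-C-P cover a p }) (C-within-ρ small-diam a)

  outside-C-far : Fin (Graph.n P) → ConditionA P k Cov →
    ∀ v → IsC v ⊎ ∃[ t ] DistGE v t (suc (suc ρ))
  outside-C-far _ _ (cV a) = inj₁ (a , refl)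
  outside-C-far _ _ (pV p) = inj₂ (tip , far-from-tip (pV p) (+-monoˡ-≤ (suc ρ) 1≤ρ))
  outside-C-far p₀ _ (xV zero j 1≤j j≤ρ) = inj₂ (pV p₀ , chain₀-far-from-P j 1≤j j≤ρ p₀)
  outside-C-far _ condA (xV (suc i) (suc zero) 1≤1 1≤ρ′) with condA i
  ... | p , p∉Pᵢ , Pᵢ-far = inj₂ (pV p , FromWitness.chain-foot-far i p p∉Pᵢ Pᵢ-far 1≤1 1≤ρ′)
  outside-C-far _ _ v@(xV (suc i) (suc (suc j)) _ _) =
    inj₂ (tip , far-from-tip v (≤-trans (≤-reflexive (+-comm 2 ρ)) (+-monoʳ-≤ ρ (s≤s (s≤s z≤n)))))

proposition2p11 : (C P : Graph) → 1 ≤ Graph.n C → 1 ≤ Graph.n P →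
    (k : ℕ) (Cov : Fin k → Fin (Graph.n P) → Bool) →
    IsCovering P k Cov → ConditionA P k Cov →
    (ρ : ℕ) → 1 ≤ ρ → (2 ≤ ρ ⊎ Metric.DiamLE (Edge C) ρ) →
    let open Construction C P k Cov ρ
        open Metric GE
    in UniformCentral
       × Radius (suc ρ)
       × (∀ v → InCenter v ⇔ (∃[ a ] (v ≡ cV a)))
       × (∀ a b → GE (cV a) (cV b) ⇔ Edge C a b)
       × (∀ v → InCP v ⇔ (∃[ p ] (v ≡ pV p)))
       × (∀ a b → GE (pV a) (pV b) ⇔ Edge P a b)
proposition2p11 C P (s≤s _) (s≤s _) k Cov cover condA ρ 1≤ρ small-diam =
    proj₁ uniform∧CP , proj₁ radius∧centre , centre⇔C
  , (λ a b → mk⇔ (λ { (cc e) → e }) cc)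
  , proj₂ uniform∧CP
  , (λ a b → mk⇔ (λ { (pp e) → e }) pp)
  where
    open Construction C P k Cov ρ
    open Metric GE
    open MetricProperties GE
    open ConstructionProperties C P k Cov ρ 1≤ρ

    C-ecc∧EC-P : ∀ a → Ecc (cV a) (suc ρ) × (∀ x → InEC (cV a) x ⇔ IsP x)
    C-ecc∧EC-P = C-ecc∧EC cover small-diam zero

    radius∧centre : Radius (suc ρ) × (∀ v → InCenter v ⇔ IsC v)
    radius∧centre = centre-characterisation IsC (cV zero , zero , refl)
      (λ { _ (a , refl) → proj₁ (C-ecc∧EC-P a) }) (outside-C-far zero condA)

    centre⇔C : ∀ v → InCenter v ⇔ IsC v
    centre⇔C = proj₂ radius∧centre

    uniform∧CP : UniformCentral × (∀ x → InCP x ⇔ IsP x)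
    uniform∧CP = uniform-central IsP (cV zero , from (centre⇔C (cV zero)) (zero , refl))
      λ c c-centre → case to (centre⇔C c) c-centre of λ { (a , refl) → proj₂ (C-ecc∧EC-P a) }
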